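{- Let $L=\langle D,\wedge,\vee\rangle$ be an arbitrary lattice, let $F(L)$ be the set of all filters of $L$, and for $a\in D$ let $f(a)=\{X\in F(L): a\in X\}$. For $a,b\in D$ define $f(a)\wedge^{*}f(b)=f(a)\cap f(b)$ and $f(a)\vee^{*}f(b)=f(a)\cup f(b)\cup\{Z\in F(L):(\exists X\in f(a))(\exists Y\in f(b))\,X\cap Y\subseteq Z\}$. Then for all $a,b\in D$: (1.1) $f(a)\wedge^{*}f(b)=f(a\wedge b)$, and (1.2) $f(a)\vee^{*}f(b)=f(a\vee b)$.
   Context: A filter of a lattice is a nonempty subset that is upward closed and closed under finite meets. -}

module Defs where

open import Level using (Level; _⊔_; suc)
open import Algebra.Lattice.Bundles using (Lattice)
open import Data.Product using (Σ; ∃; _×_; _,_)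
open import Data.Sum using (_⊎_)
open import Function.Bundles using (_⇔_)

module FilterDefs {c ℓ : Level} (L : Lattice c ℓ) where
  open Lattice L public

  _≤_ : Carrier → Carrier → Set ℓ
  x ≤ y = (x ∧ y) ≈ x

  Subset : Set (suc (c ⊔ ℓ))
  Subset = Carrier → Set (c ⊔ ℓ)

  record IsFilter (X : Subset) : Set (c ⊔ ℓ) where
    field
      nonempty : ∃ λ x → X x
      upward   : ∀ {x y} → x ≤ y → X x → X y
      meet     : ∀ {x y} → X x → X y → X (x ∧ y)

  Filter : Set (suc (c ⊔ ℓ))
  Filter = Σ Subset IsFilter

  carrierOf : Filter → Subset
  carrierOf (X , _) = X


  FSet : Set (suc (suc (c ⊔ ℓ)))
  FSet = Filter → Set (suc (c ⊔ ℓ))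

  f : Carrier → FSet
  f a X = Level.Lift (suc (c ⊔ ℓ)) (carrierOf X a)

  _∩_ : FSet → FSet → FSet
  (A ∩ B) X = A X × B X

  _∪_ : FSet → FSet → FSet
  (A ∪ B) X = A X ⊎ B X

  _∩_⊆_ : Filter → Filter → Filter → Set (c ⊔ ℓ)
  X ∩ Y ⊆ Z = ∀ x → carrierOf X x → carrierOf Y x → carrierOf Z x

  _∧*_ : FSet → FSet → FSet
  A ∧* B = A ∩ B

  _∨*_ : FSet → FSet → FSet
  (A ∨* B) Z = (A ∪ B) Z ⊎ (∃ λ X → ∃ λ Y → A X × B Y × (X ∩ Y ⊆ Z))

  _≐_ : FSet → FSet → Set (suc (c ⊔ ℓ))
  A ≐ B = ∀ Z → A Z ⇔ B Z

-- A filter contains a ∧ b iff it contains a and b, since it is closed under meets and upward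
-- closed. Every filter containing a or b contains a ∨ b; conversely, if a ∨ b ∈ Z then the
-- principal filters ↑a and ↑b witness the third clause of ∨*: any x ∈ ↑a ∩ ↑b is an upper
-- bound of a and b, hence lies above a ∨ b and so in Z.
module Submission where

open import Defs
open import Level using (Level; Lift; lift; lower)
open import Algebra.Lattice.Bundles using (Lattice)
open import Data.Product using (_×_; _,_)
open import Data.Sum using (inj₁; inj₂)
open import Function.Bundles using (mk⇔)
import Algebra.Lattice.Properties.Lattice as LatticeProperties
import Relation.Binary.Lattice as OrderLattice

module _ {c ℓ : Level} (L : Lattice c ℓ) where
  open FilterDefs L
  private
    module O = OrderLattice.Lattice (LatticeProperties.∨-∧-orderTheoreticLattice L)

    -- The library orders a lattice by x ≈ x ∧ y, whereas _≤_ here is x ∧ y ≈ x.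
    fromOrder : ∀ {x y} → x O.≤ y → x ≤ y
    fromOrder = sym

    toOrder : ∀ {x y} → x ≤ y → x O.≤ y
    toOrder = sym

  ≤-refl : ∀ {x} → x ≤ x
  ≤-refl = fromOrder O.refl

  ≤-trans : ∀ {x y z} → x ≤ y → y ≤ z → x ≤ z
  ≤-trans p q = fromOrder (O.trans (toOrder p) (toOrder q))

  ≤-∧-greatest : ∀ {x y z} → x ≤ y → x ≤ z → x ≤ (y ∧ z)
  ≤-∧-greatest p q = fromOrder (O.∧-greatest (toOrder p) (toOrder q))

  ≤-∨-least : ∀ {x y z} → x ≤ z → y ≤ z → (x ∨ y) ≤ z
  ≤-∨-least p q = fromOrder (O.∨-least (toOrder p) (toOrder q))

  principal : Carrier → Filter
  principal a = (λ x → Lift c (a ≤ x)) , record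
    { nonempty = a , lift ≤-refl
    ; upward   = λ x≤y a≤x → lift (≤-trans (lower a≤x) x≤y)
    ; meet     = λ a≤x a≤y → lift (≤-∧-greatest (lower a≤x) (lower a≤y))
    }

  f-principal : ∀ a → f a (principal a)
  f-principal a = lift (lift ≤-refl)

  f-antitone : ∀ {a b} → a ≤ b → ∀ Z → f a Z → f b Z
  f-antitone a≤b (_ , F) (lift a∈Z) = lift (IsFilter.upward F a≤b a∈Z)

  f-∧ : ∀ a b → (f a ∧* f b) ≐ f (a ∧ b)
  f-∧ a b Z@(_ , F) = mk⇔
    (λ { (lift a∈Z , lift b∈Z) → lift (IsFilter.meet F a∈Z b∈Z) })
    (λ a∧b∈Z → f-antitone (fromOrder (O.x∧y≤x a b)) Z a∧b∈Z
             , f-antitone (fromOrder (O.x∧y≤y a b)) Z a∧b∈Z)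

  f-∨ : ∀ a b → (f a ∨* f b) ≐ f (a ∨ b)
  f-∨ a b Z@(_ , F) = mk⇔ to from
    where
    a≤a∨b : a ≤ (a ∨ b)
    a≤a∨b = fromOrder (O.x≤x∨y a b)

    b≤a∨b : b ≤ (a ∨ b)
    b≤a∨b = fromOrder (O.y≤x∨y a b)

    to : (f a ∨* f b) Z → f (a ∨ b) Z
    to (inj₁ (inj₁ a∈Z)) = f-antitone a≤a∨b Z a∈Z
    to (inj₁ (inj₂ b∈Z)) = f-antitone b≤a∨b Z b∈Z
    to (inj₂ (X , Y , a∈X , b∈Y , X∩Y⊆Z)) =
      lift (X∩Y⊆Z (a ∨ b) (lower (f-antitone a≤a∨b X a∈X)) (lower (f-antitone b≤a∨b Y b∈Y)))

    from : f (a ∨ b) Z → (f a ∨* f b) Z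
    from (lift a∨b∈Z) = inj₂ (principal a , principal b , f-principal a , f-principal b ,
      λ x a≤x b≤x → IsFilter.upward F (≤-∨-least (lower a≤x) (lower b≤x)) a∨b∈Z)

proposition1 : ∀ {c ℓ : Level} (L : Lattice c ℓ) → let open FilterDefs L in ∀ (a b : Carrier) → ((f a ∧* f b) ≐ f (a ∧ b)) × ((f a ∨* f b) ≐ f (a ∨ b))
proposition1 L a b = f-∧ L a b , f-∨ L a b
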